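{- As formal power series in $x$, $$c_1^4e^{\alpha x}+c_2^4e^{\beta x}+c_3^4e^{\gamma x}=\frac{1}{484}\sum_{n=0}^\infty T_n^{(2,14,21)}\frac{x^n}{n!}.$$
   Context: Let $\alpha,\beta,\gamma$ be the three distinct complex roots of $x^3-x^2-x-1=0$, and set $c_1=\frac{\alpha}{(\alpha-\beta)(\alpha-\gamma)}$, $c_2=\frac{\beta}{(\beta-\alpha)(\beta-\gamma)}$, $c_3=\frac{\gamma}{(\gamma-\alpha)(\gamma-\beta)}$. For numbers $s_0,s_1,s_2$, the sequence $T_n^{(s_0,s_1,s_2)}$ is defined by $T_0^{(s_0,s_1,s_2)}=s_0$, $T_1^{(s_0,s_1,s_2)}=s_1$, $T_2^{(s_0,s_1,s_2)}=s_2$ and $T_n^{(s_0,s_1,s_2)}=T_{n-1}^{(s_0,s_1,s_2)}+T_{n-2}^{(s_0,s_1,s_2)}+T_{n-3}^{(s_0,s_1,s_2)}$ for $n\ge3$. -}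

module Defs where

open import Level using (Level; _⊔_) renaming (suc to lsuc)
open import Data.Nat.Base as ℕ using (ℕ; zero; suc; NonZero)
open import Data.Nat.Base using (_!)
import Data.Nat.Properties as ℕP
open import Data.Empty using (⊥-elim)
open import Relation.Nullary using (¬_)
open import Algebra.Bundles using (CommutativeRing; Semiring)
import Algebra.Properties.Group as GroupProps
import Algebra.Definitions.RawSemiring as RawSemiringDefs
import Relation.Binary.Reasoning.Setoid as SetoidReasoning

record Field (c ℓ : Level) : Set (lsuc (c ⊔ ℓ)) where
  field
    commutativeRing : CommutativeRing c ℓ
  open CommutativeRing commutativeRing public
  open RawSemiringDefs (Semiring.rawSemiring semiring) public using (_^_; _×_)
  field
    1≉0     : ¬ (1# ≈ 0#)
    _⁻¹⟨_⟩  : (x : Carrier) → ¬ (x ≈ 0#) → Carrier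
    inverse : ∀ x (x≉0 : ¬ (x ≈ 0#)) → x * (x ⁻¹⟨ x≉0 ⟩) ≈ 1#

  fromℕ : ℕ → Carrier
  fromℕ n = n × 1#

  diff≉0 : ∀ {x y} → ¬ (x ≈ y) → ¬ ((x - y) ≈ 0#)
  diff≉0 {x} {y} x≉y d = x≉y (GroupProps.x∙y⁻¹≈ε⇒x≈y +-group x y d)

  mul≉0 : ∀ {a b} → ¬ (a ≈ 0#) → ¬ (b ≈ 0#) → ¬ ((a * b) ≈ 0#)
  mul≉0 {a} {b} a≉0 b≉0 ab≈0 = b≉0 (begin
      b                        ≈⟨ sym (*-identityˡ b) ⟩
      1# * b                   ≈⟨ *-congʳ (sym (inverse a a≉0)) ⟩
      (a * a⁻¹) * b            ≈⟨ *-congʳ (*-comm a a⁻¹) ⟩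
      (a⁻¹ * a) * b            ≈⟨ *-assoc a⁻¹ a b ⟩
      a⁻¹ * (a * b)            ≈⟨ *-congˡ ab≈0 ⟩
      a⁻¹ * 0#                 ≈⟨ zeroʳ a⁻¹ ⟩
      0#                       ∎)
    where
    open SetoidReasoning setoid
    a⁻¹ = a ⁻¹⟨ a≉0 ⟩

  _/_⟨_⟩ : Carrier → (y : Carrier) → ¬ (y ≈ 0#) → Carrier
  x / y ⟨ y≉0 ⟩ = x * (y ⁻¹⟨ y≉0 ⟩)

CharZero : ∀ {c ℓ} → Field c ℓ → Set ℓ
CharZero K = ∀ n → ¬ (fromℕ (suc n) ≈ 0#)
  where open Field K

module _ {c ℓ} (K : Field c ℓ) where
  open Field K

  T : Carrier → Carrier → Carrier → ℕ → Carrier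
  T s₀ s₁ s₂ zero                = s₀
  T s₀ s₁ s₂ (suc zero)          = s₁
  T s₀ s₁ s₂ (suc (suc zero))    = s₂
  T s₀ s₁ s₂ (suc (suc (suc n))) =
    T s₀ s₁ s₂ (suc (suc n)) + T s₀ s₁ s₂ (suc n) + T s₀ s₁ s₂ n

-- Formal power series over a field of characteristic zero,
-- represented by their coefficient sequences: f = Σₙ f n · xⁿ.
module PowerSeries {c ℓ} (K : Field c ℓ) (char0 : CharZero K) where
  open Field K

  infix 4 _≈ₛ_
  infixl 6 _+ₛ_
  infixr 7 _·ₛ_

  FPS : Set c
  FPS = ℕ → Carrier

  _≈ₛ_ : FPS → FPS → Set ℓ
  f ≈ₛ g = ∀ n → f n ≈ g n

  _+ₛ_ : FPS → FPS → FPS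
  (f +ₛ g) n = f n + g n

  _·ₛ_ : Carrier → FPS → FPS
  (a ·ₛ f) n = a * f n

  fact≉0 : ∀ n → ¬ (fromℕ (n !) ≈ 0#)
  fact≉0 n = go (n !) (n ℕP.!≢0)
    where
    go : ∀ k → NonZero k → ¬ (fromℕ k ≈ 0#)
    go zero    nz = ⊥-elim (NonZero.nonZero nz)
    go (suc m) _  = char0 m

  egf : (ℕ → Carrier) → FPS
  egf a n = a n / fromℕ (n !) ⟨ fact≉0 n ⟩

  exp : Carrier → FPS
  exp a = egf (λ n → a ^ n)

module _ {c ℓ} (K : Field c ℓ) where
  open Field K

  IsTribRoot : Carrier → Set ℓ
  IsTribRoot x = (x ^ 3) - (x ^ 2) - x - 1# ≈ 0#

  cCoeff : (a b d : Carrier) → ¬ (a ≈ b) → ¬ (a ≈ d) → Carrier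
  cCoeff a b d a≉b a≉d =
    a / ((a - b) * (a - d)) ⟨ mul≉0 (diff≉0 a≉b) (diff≉0 a≉d) ⟩

{-# OPTIONS --safe #-}
module Submission where

open import Defs
open import Data.Nat.Base as ℕ using (ℕ; zero; suc)
import Data.Nat.Properties as ℕP
open import Data.Integer.Base as ℤ using (ℤ; +_; -[1+_]; +0; +[1+_]; _◃_; _⊖_; sign; ∣_∣)
import Data.Integer.Properties as ℤP
open import Data.Sign.Base as Sign using (Sign)
open import Data.Maybe.Base using (Maybe; just; nothing)
open import Relation.Nullary using (¬_; yes; no)
import Relation.Binary.PropositionalEquality as ≡
open import Algebra.Bundles using (CommutativeRing)
open import Algebra.Solver.Ring.AlmostCommutativeRing
  using (fromCommutativeRing; _-Raw-AlmostCommutative⟶_)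
import Relation.Binary.Reasoning.Setoid as SetoidReasoning

-- Let f = x³ - x² - x - 1. For a root x with other roots y, z we have (x - y)(x - z) = f'(x), so
-- c = x / f'(x); reducing modulo f gives 22 c = 5x² - 3x - 4 and then 968 c⁴ = 4x² + x - 3.
-- Hence 968 Σᵢ cᵢ⁴ αᵢⁿ = 4 pₙ₊₂ + pₙ₊₁ - 3 pₙ for the power sums pₙ = αⁿ + βⁿ + γⁿ. These form the
-- tribonacci sequence T^(3,1,3) (Newton's identities with e₁ = 1, e₂ = -1), so 4 pₙ₊₂ + pₙ₊₁ - 3 pₙ is
-- a tribonacci sequence starting 4, 28, 42, that is, 2 T^(2,14,21).

module IntegerCoefficientSolver {c ℓ} (R : CommutativeRing c ℓ) where
  open CommutativeRing R
  open import Algebra.Properties.Semiring.Mult semiring using (_×_; ×-homo-+; ×1-homo-*)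
  open import Algebra.Properties.Ring ring using (-1*x≈-x)
  open import Algebra.Properties.AbelianGroup +-abelianGroup using (⁻¹-∙-comm; ⁻¹-involutive; ε⁻¹≈ε)
  open import Algebra.Properties.CommutativeSemigroup +-commutativeSemigroup
    using () renaming (interchange to +-interchange)
  open import Algebra.Properties.CommutativeSemigroup *-commutativeSemigroup
    using () renaming (interchange to *-interchange)
  open SetoidReasoning setoid

  fromℤ : ℤ → Carrier
  fromℤ (+ n)    = n × 1#
  fromℤ -[1+ n ] = - (suc n × 1#)

  fromSign : Sign → Carrier
  fromSign Sign.+ = 1#
  fromSign Sign.- = - 1#

  fromSign-homo-* : ∀ s t → fromSign (s Sign.* t) ≈ fromSign s * fromSign t
  fromSign-homo-* Sign.+ Sign.+ = sym (*-identityˡ _)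
  fromSign-homo-* Sign.+ Sign.- = sym (*-identityˡ _)
  fromSign-homo-* Sign.- Sign.+ = sym (*-identityʳ _)
  fromSign-homo-* Sign.- Sign.- = sym (trans (-1*x≈-x _) (⁻¹-involutive _))

  fromℤ-◃ : ∀ s n → fromℤ (s ◃ n) ≈ fromSign s * (n × 1#)
  fromℤ-◃ s      zero    = sym (zeroʳ _)
  fromℤ-◃ Sign.+ (suc n) = sym (*-identityˡ _)
  fromℤ-◃ Sign.- (suc n) = sym (-1*x≈-x _)

  fromℤ-sign-abs : ∀ i → fromℤ i ≈ fromSign (sign i) * (∣ i ∣ × 1#)
  fromℤ-sign-abs i = trans (reflexive (≡.cong fromℤ (≡.sym (ℤP.◃-inverse i)))) (fromℤ-◃ (sign i) ∣ i ∣)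

  fromℤ-⊖ : ∀ m n → fromℤ (m ⊖ n) ≈ m × 1# - n × 1#
  fromℤ-⊖ m       zero    = sym (trans (+-congˡ ε⁻¹≈ε) (+-identityʳ _))
  fromℤ-⊖ zero    (suc n) = sym (+-identityˡ _)
  fromℤ-⊖ (suc m) (suc n) = begin
    fromℤ (suc m ⊖ suc n)              ≡⟨ ≡.cong fromℤ (ℤP.[1+m]⊖[1+n]≡m⊖n m n) ⟩
    fromℤ (m ⊖ n)                      ≈⟨ fromℤ-⊖ m n ⟩
    m × 1# - n × 1#                    ≈⟨ +-identityˡ _ ⟨
    0# + (m × 1# - n × 1#)             ≈⟨ +-congʳ (-‿inverseʳ 1#) ⟨
    (1# - 1#) + (m × 1# - n × 1#)      ≈⟨ +-interchange _ _ _ _ ⟩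
    (1# + m × 1#) + (- 1# - n × 1#)    ≈⟨ +-congˡ (⁻¹-∙-comm _ _) ⟩
    (1# + m × 1#) - (1# + n × 1#)      ∎

  fromℤ-homo-+ : ∀ i j → fromℤ (i ℤ.+ j) ≈ fromℤ i + fromℤ j
  fromℤ-homo-+ (+ m)    (+ n)    = ×-homo-+ 1# m n
  fromℤ-homo-+ (+ m)    -[1+ n ] = fromℤ-⊖ m (suc n)
  fromℤ-homo-+ -[1+ m ] (+ n)    = trans (fromℤ-⊖ n (suc m)) (+-comm _ _)
  fromℤ-homo-+ -[1+ m ] -[1+ n ] = begin
    - (suc (suc (m ℕ.+ n)) × 1#)           ≡⟨ ≡.cong (λ k → - (suc k × 1#)) (ℕP.+-suc m n) ⟨
    - ((suc m ℕ.+ suc n) × 1#)             ≈⟨ -‿cong (×-homo-+ 1# (suc m) (suc n)) ⟩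
    - (suc m × 1# + suc n × 1#)            ≈⟨ ⁻¹-∙-comm _ _ ⟨
    - (suc m × 1#) + - (suc n × 1#)        ∎

  fromℤ-homo-* : ∀ i j → fromℤ (i ℤ.* j) ≈ fromℤ i * fromℤ j
  fromℤ-homo-* i j = begin
    fromℤ (i ℤ.* j)                                       ≈⟨ fromℤ-◃ (sign i Sign.* sign j) (∣ i ∣ ℕ.* ∣ j ∣) ⟩
    fromSign (sign i Sign.* sign j) * ((∣ i ∣ ℕ.* ∣ j ∣) × 1#)
      ≈⟨ *-cong (fromSign-homo-* (sign i) (sign j)) (×1-homo-* ∣ i ∣ ∣ j ∣) ⟩
    (fromSign (sign i) * fromSign (sign j)) * (∣ i ∣ × 1# * ∣ j ∣ × 1#) ≈⟨ *-interchange _ _ _ _ ⟩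
    (fromSign (sign i) * ∣ i ∣ × 1#) * (fromSign (sign j) * ∣ j ∣ × 1#)
      ≈⟨ *-cong (fromℤ-sign-abs i) (fromℤ-sign-abs j) ⟨
    fromℤ i * fromℤ j                                     ∎

  fromℤ-homo-- : ∀ i → fromℤ (ℤ.- i) ≈ - fromℤ i
  fromℤ-homo-- -[1+ n ] = sym (⁻¹-involutive _)
  fromℤ-homo-- +0       = sym ε⁻¹≈ε
  fromℤ-homo-- +[1+ n ] = refl

  -- The solver evaluates the constant 1 to 1# itself rather than to fromℤ 1 = 1# + 0#,
  -- so that its output matches hypotheses written with 1#.
  coefficient : ℤ → Carrier
  coefficient +[1+ 0 ] = 1#
  coefficient i        = fromℤ i

  coefficient≈fromℤ : ∀ i → coefficient i ≈ fromℤ i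
  coefficient≈fromℤ +[1+ 0 ]          = sym (+-identityʳ 1#)
  coefficient≈fromℤ +0                = refl
  coefficient≈fromℤ +[1+ suc n ]      = refl
  coefficient≈fromℤ -[1+ n ]          = refl

  coefficient-morphism : ℤ.+-*-rawRing -Raw-AlmostCommutative⟶ fromCommutativeRing R
  coefficient-morphism = record
    { ⟦_⟧    = coefficient
    ; +-homo = λ i j → trans (coefficient≈fromℤ (i ℤ.+ j)) (trans (fromℤ-homo-+ i j)
                         (sym (+-cong (coefficient≈fromℤ i) (coefficient≈fromℤ j))))
    ; *-homo = λ i j → trans (coefficient≈fromℤ (i ℤ.* j)) (trans (fromℤ-homo-* i j)
                         (sym (*-cong (coefficient≈fromℤ i) (coefficient≈fromℤ j))))
    ; -‿homo = λ i → trans (coefficient≈fromℤ (ℤ.- i)) (trans (fromℤ-homo-- i)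
                         (sym (-‿cong (coefficient≈fromℤ i))))
    ; 0-homo = refl
    ; 1-homo = refl
    }

  coefficient-≟ : ∀ i j → Maybe (coefficient i ≈ coefficient j)
  coefficient-≟ i j with i ℤP.≟ j
  ... | yes ≡.refl = just refl
  ... | no _       = nothing

  open import Algebra.Solver.Ring ℤ.+-*-rawRing (fromCommutativeRing R) coefficient-morphism coefficient-≟ public

module Vanishing {c ℓ} (R : CommutativeRing c ℓ) where
  open CommutativeRing R

  ≈-modulo : ∀ {x y e} → x ≈ y + e → e ≈ 0# → x ≈ y
  ≈-modulo x≈y+e e≈0 = trans x≈y+e (trans (+-congˡ e≈0) (+-identityʳ _))

  difference-vanishing : ∀ {x y} → x ≈ 0# → y ≈ 0# → x - y ≈ 0#
  difference-vanishing x≈0 y≈0 = trans (+-congˡ (-‿cong y≈0)) (trans (+-congʳ x≈0) (-‿inverseʳ 0#))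

  multiple-vanishing : ∀ x {y} → y ≈ 0# → x * y ≈ 0#
  multiple-vanishing x y≈0 = trans (*-congˡ y≈0) (zeroʳ x)

module Tribonacci {c ℓ} (R : CommutativeRing c ℓ) where
  open CommutativeRing R
  open import Data.Product.Base using (_×_; _,_; proj₁)
  open IntegerCoefficientSolver R using (solve; _:=_; _:+_; _:-_; _:*_)
  open SetoidReasoning setoid

  IsTribonacci : (ℕ → Carrier) → Set ℓ
  IsTribonacci a = ∀ n → a (3 ℕ.+ n) ≈ a (2 ℕ.+ n) + a (1 ℕ.+ n) + a n

  tribonacci-unique : ∀ {a b} → IsTribonacci a → IsTribonacci b →
                      a 0 ≈ b 0 → a 1 ≈ b 1 → a 2 ≈ b 2 → ∀ n → a n ≈ b n
  tribonacci-unique {a} {b} trib-a trib-b a₀≈b₀ a₁≈b₁ a₂≈b₂ n = proj₁ (agree n)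
    where
    agree : ∀ n → a n ≈ b n × a (1 ℕ.+ n) ≈ b (1 ℕ.+ n) × a (2 ℕ.+ n) ≈ b (2 ℕ.+ n)
    agree zero    = a₀≈b₀ , a₁≈b₁ , a₂≈b₂
    agree (suc n) with agree n
    ... | aₙ≈bₙ , aₙ₊₁≈bₙ₊₁ , aₙ₊₂≈bₙ₊₂ = aₙ₊₁≈bₙ₊₁ , aₙ₊₂≈bₙ₊₂ , (begin
      a (3 ℕ.+ n)                           ≈⟨ trib-a n ⟩
      a (2 ℕ.+ n) + a (1 ℕ.+ n) + a n       ≈⟨ +-cong (+-cong aₙ₊₂≈bₙ₊₂ aₙ₊₁≈bₙ₊₁) aₙ≈bₙ ⟩
      b (2 ℕ.+ n) + b (1 ℕ.+ n) + b n       ≈⟨ trib-b n ⟨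
      b (3 ℕ.+ n)                           ∎)

  IsTribonacci-shift : ∀ {a} → IsTribonacci a → IsTribonacci (λ n → a (suc n))
  IsTribonacci-shift trib-a n = trib-a (suc n)

  IsTribonacci-+ : ∀ {a b} → IsTribonacci a → IsTribonacci b → IsTribonacci (λ n → a n + b n)
  IsTribonacci-+ {a} {b} trib-a trib-b n = trans (+-cong (trib-a n) (trib-b n))
    (solve 6 (λ a₂ a₁ a₀ b₂ b₁ b₀ →
       (a₂ :+ a₁ :+ a₀) :+ (b₂ :+ b₁ :+ b₀) := (a₂ :+ b₂) :+ (a₁ :+ b₁) :+ (a₀ :+ b₀))
       refl (a (2 ℕ.+ n)) (a (1 ℕ.+ n)) (a n) (b (2 ℕ.+ n)) (b (1 ℕ.+ n)) (b n))

  IsTribonacci-- : ∀ {a b} → IsTribonacci a → IsTribonacci b → IsTribonacci (λ n → a n - b n)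
  IsTribonacci-- {a} {b} trib-a trib-b n = trans (+-cong (trib-a n) (-‿cong (trib-b n)))
    (solve 6 (λ a₂ a₁ a₀ b₂ b₁ b₀ →
       (a₂ :+ a₁ :+ a₀) :- (b₂ :+ b₁ :+ b₀) := (a₂ :- b₂) :+ (a₁ :- b₁) :+ (a₀ :- b₀))
       refl (a (2 ℕ.+ n)) (a (1 ℕ.+ n)) (a n) (b (2 ℕ.+ n)) (b (1 ℕ.+ n)) (b n))

  IsTribonacci-*ˡ : ∀ k {a} → IsTribonacci a → IsTribonacci (λ n → k * a n)
  IsTribonacci-*ˡ k {a} trib-a n = trans (*-congˡ (trib-a n))
    (solve 4 (λ k a₂ a₁ a₀ → k :* (a₂ :+ a₁ :+ a₀) := k :* a₂ :+ k :* a₁ :+ k :* a₀)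
       refl k (a (2 ℕ.+ n)) (a (1 ℕ.+ n)) (a n))

module FieldCancellation {c ℓ} (K : Field c ℓ) where
  open Field K
  open SetoidReasoning setoid

  x≉0⇒x*y≈0⇒y≈0 : ∀ {x y} → ¬ (x ≈ 0#) → x * y ≈ 0# → y ≈ 0#
  x≉0⇒x*y≈0⇒y≈0 {x} {y} x≉0 xy≈0 = begin
    y                        ≈⟨ *-identityˡ y ⟨
    1# * y                   ≈⟨ *-congʳ (trans (*-comm x⁻¹ x) (inverse x x≉0)) ⟨
    (x⁻¹ * x) * y            ≈⟨ *-assoc x⁻¹ x y ⟩
    x⁻¹ * (x * y)            ≈⟨ multiple-vanishing x⁻¹ xy≈0 ⟩
    0#                       ∎
    where
    open Vanishing commutativeRing using (multiple-vanishing)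
    x⁻¹ : Carrier
    x⁻¹ = x ⁻¹⟨ x≉0 ⟩

  *-cancelˡ : ∀ {x y z} → ¬ (x ≈ 0#) → x * y ≈ x * z → y ≈ z
  *-cancelˡ {x} {y} {z} x≉0 xy≈xz = x∙y⁻¹≈ε⇒x≈y y z (x≉0⇒x*y≈0⇒y≈0 x≉0 (begin
    x * (y - z)              ≈⟨ distribˡ x y (- z) ⟩
    x * y + x * - z          ≈⟨ +-congˡ (-‿distribʳ-* x z) ⟨
    x * y - x * z            ≈⟨ x≈y⇒x∙y⁻¹≈ε xy≈xz ⟩
    0#                       ∎))
    where
    open import Algebra.Properties.Group +-group using (x∙y⁻¹≈ε⇒x≈y; x≈y⇒x∙y⁻¹≈ε)
    open import Algebra.Properties.Ring ring using (-‿distribʳ-*)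

  x≈y*z⇒x/z≈y : ∀ {x y z} (z≉0 : ¬ (z ≈ 0#)) → x ≈ y * z → x / z ⟨ z≉0 ⟩ ≈ y
  x≈y*z⇒x/z≈y {x} {y} {z} z≉0 x≈yz = begin
    x * z ⁻¹⟨ z≉0 ⟩          ≈⟨ *-congʳ x≈yz ⟩
    (y * z) * z ⁻¹⟨ z≉0 ⟩    ≈⟨ *-assoc y z _ ⟩
    y * (z * z ⁻¹⟨ z≉0 ⟩)    ≈⟨ *-congˡ (inverse z z≉0) ⟩
    y * 1#                   ≈⟨ *-identityʳ y ⟩
    y                        ∎

module TribonacciRoots {k ℓ} (K : Field k ℓ) where
  open Field K hiding (_×_)
  open IntegerCoefficientSolver commutativeRing
  open Vanishing commutativeRing
  open FieldCancellation K
  open Tribonacci commutativeRing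
  open import Algebra.Properties.Group +-group using (x∙y⁻¹≈ε⇒x≈y; x≈y⇒x∙y⁻¹≈ε)
  open SetoidReasoning setoid

  T-tribonacci : ∀ {s₀ s₁ s₂} → IsTribonacci (T K s₀ s₁ s₂)
  T-tribonacci n = refl

  lucas : ℕ → Carrier
  lucas = T K (fromℕ 3) 1# (fromℕ 3)

  lucas-combination : ∀ n → fromℕ 4 * lucas (2 ℕ.+ n) + lucas (1 ℕ.+ n) - fromℕ 3 * lucas n
                            ≈ fromℕ 2 * T K (fromℕ 2) (fromℕ 14) (fromℕ 21) n
  lucas-combination = tribonacci-unique
    (IsTribonacci-- (IsTribonacci-+ (IsTribonacci-*ˡ (fromℕ 4) (IsTribonacci-shift (IsTribonacci-shift T-tribonacci)))
                                    (IsTribonacci-shift T-tribonacci))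
                    (IsTribonacci-*ˡ (fromℕ 3) T-tribonacci))
    (IsTribonacci-*ˡ (fromℕ 2) T-tribonacci)
    (solve 0 (con (+ 4) :* con (+ 3) :+ con (+ 1) :- con (+ 3) :* con (+ 3) := con (+ 2) :* con (+ 2)) refl)
    (solve 0 (con (+ 4) :* L₃ :+ con (+ 3) :- con (+ 3) :* con (+ 1) := con (+ 2) :* con (+ 14)) refl)
    (solve 0 (con (+ 4) :* (L₃ :+ con (+ 3) :+ con (+ 1)) :+ L₃ :- con (+ 3) :* con (+ 3)
              := con (+ 2) :* con (+ 21)) refl)
    where
    L₃ : Polynomial 0
    L₃ = con (+ 3) :+ con (+ 1) :+ con (+ 3)

  tribRoot-powers : ∀ {x} → IsTribRoot K x → IsTribonacci (x ^_)
  tribRoot-powers {x} x-root n = ≈-modulo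
    (solve 2 (λ x xⁿ →
      x :* (x :* (x :* xⁿ)) := x :* (x :* xⁿ) :+ x :* xⁿ :+ xⁿ :+ xⁿ :* (x :^ 3 :- x :^ 2 :- x :- con (+ 1)))
      refl x (x ^ n))
    (multiple-vanishing (x ^ n) x-root)

  tribRoots-quadratic : ∀ {x y} → IsTribRoot K x → IsTribRoot K y → ¬ (x ≈ y) →
                        x * x + x * y + y * y - x - y - 1# ≈ 0#
  tribRoots-quadratic {x} {y} x-root y-root x≉y = x≉0⇒x*y≈0⇒y≈0 (diff≉0 x≉y) (trans
    (solve 2 (λ x y →
      (x :- y) :* (x :* x :+ x :* y :+ y :* y :- x :- y :- con (+ 1))
      := (x :^ 3 :- x :^ 2 :- x :- con (+ 1)) :- (y :^ 3 :- y :^ 2 :- y :- con (+ 1))) refl x y)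
    (difference-vanishing x-root y-root))

  module _ {x y z} (x-root : IsTribRoot K x) (y-root : IsTribRoot K y) (z-root : IsTribRoot K z)
           (x≉y : ¬ (x ≈ y)) (x≉z : ¬ (x ≈ z)) (y≉z : ¬ (y ≈ z)) where

    private
      xy-quadratic : x * x + x * y + y * y - x - y - 1# ≈ 0#
      xy-quadratic = tribRoots-quadratic x-root y-root x≉y

    tribRoots-sum : x + y + z ≈ 1#
    tribRoots-sum = x∙y⁻¹≈ε⇒x≈y _ _ (x≉0⇒x*y≈0⇒y≈0 (diff≉0 y≉z) (trans
      (solve 3 (λ x y z →
        (y :- z) :* (x :+ y :+ z :- con (+ 1))
        := (x :* x :+ x :* y :+ y :* y :- x :- y :- con (+ 1))
           :- (x :* x :+ x :* z :+ z :* z :- x :- z :- con (+ 1))) refl x y z)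
      (difference-vanishing xy-quadratic (tribRoots-quadratic x-root z-root x≉z))))

    private
      sum-1≈0 : x + y + z - 1# ≈ 0#
      sum-1≈0 = x≈y⇒x∙y⁻¹≈ε tribRoots-sum

    tribRoots-sumOfPairProducts : x * y + x * z + y * z ≈ - 1#
    tribRoots-sumOfPairProducts = ≈-modulo
      (solve 3 (λ x y z →
        x :* y :+ x :* z :+ y :* z
        := :- con (+ 1) :+ ((x :+ y) :* (x :+ y :+ z :- con (+ 1))
                             :- (x :* x :+ x :* y :+ y :* y :- x :- y :- con (+ 1)))) refl x y z)
      (difference-vanishing (multiple-vanishing (x + y) sum-1≈0) xy-quadratic)

    tribRoots-derivative : (x - y) * (x - z) ≈ fromℕ 3 * x * x - fromℕ 2 * x - 1#
    tribRoots-derivative = ≈-modulo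
      (solve 3 (λ x y z →
        (x :- y) :* (x :- z)
        := (con (+ 3) :* x :* x :- con (+ 2) :* x :- con (+ 1))
           :+ ((y :- x) :* (x :+ y :+ z :- con (+ 1))
               :- (x :* x :+ x :* y :+ y :* y :- x :- y :- con (+ 1)))) refl x y z)
      (difference-vanishing (multiple-vanishing (y - x) sum-1≈0) xy-quadratic)

    22*cCoeff : fromℕ 22 * cCoeff K x y z x≉y x≉z ≈ fromℕ 5 * x * x - fromℕ 3 * x - fromℕ 4
    22*cCoeff = begin
      fromℕ 22 * (x / D ⟨ D≉0 ⟩)      ≈⟨ *-assoc (fromℕ 22) x _ ⟨
      (fromℕ 22 * x) / D ⟨ D≉0 ⟩      ≈⟨ x≈y*z⇒x/z≈y D≉0 22x≈wD ⟩
      w                               ∎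
      where
      D : Carrier
      D = (x - y) * (x - z)
      D≉0 : ¬ (D ≈ 0#)
      D≉0 = mul≉0 (diff≉0 x≉y) (diff≉0 x≉z)
      w : Carrier
      w = fromℕ 5 * x * x - fromℕ 3 * x - fromℕ 4
      22x≈wD : fromℕ 22 * x ≈ w * D
      22x≈wD = begin
        fromℕ 22 * x                                     ≈⟨ ≈-modulo
          (solve 1 (λ x →
            (con (+ 5) :* x :* x :- con (+ 3) :* x :- con (+ 4)) :* (con (+ 3) :* x :* x :- con (+ 2) :* x :- con (+ 1))
            := con (+ 22) :* x :+ (con (+ 15) :* x :- con (+ 4)) :* (x :^ 3 :- x :^ 2 :- x :- con (+ 1))) refl x)
          (multiple-vanishing _ x-root) ⟨
        w * (fromℕ 3 * x * x - fromℕ 2 * x - 1#)          ≈⟨ *-congˡ tribRoots-derivative ⟨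
        w * D                                            ∎

    968*cCoeff^4 : CharZero K →
                   fromℕ 968 * cCoeff K x y z x≉y x≉z ^ 4 ≈ fromℕ 4 * x * x + x - fromℕ 3
    968*cCoeff^4 char0 = *-cancelˡ (char0 241) (begin
      fromℕ 242 * (fromℕ 968 * c ^ 4)        ≈⟨ solve 1 (λ c →
        con (+ 242) :* (con (+ 968) :* c :^ 4) := (con (+ 22) :* c) :^ 4) refl c ⟩
      (fromℕ 22 * c) ^ 4                     ≈⟨ ^-congˡ 4 22*cCoeff ⟩
      (fromℕ 5 * x * x - fromℕ 3 * x - fromℕ 4) ^ 4
        ≈⟨ ≈-modulo (solve 1 (λ x →
             (con (+ 5) :* x :* x :- con (+ 3) :* x :- con (+ 4)) :^ 4
             := con (+ 242) :* (con (+ 4) :* x :* x :+ x :- con (+ 3))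
                :+ (con (+ 625) :* x :^ 5 :- con (+ 875) :* x :^ 4 :- con (+ 900) :* x :^ 3
                    :+ con (+ 1910) :* x :^ 2 :+ con (+ 456) :* x :- con (+ 982))
                   :* (x :^ 3 :- x :^ 2 :- x :- con (+ 1))) refl x)
           (multiple-vanishing _ x-root) ⟩
      fromℕ 242 * (fromℕ 4 * x * x + x - fromℕ 3) ∎)
      where
      open import Algebra.Properties.Semiring.Exp semiring using (^-congˡ)
      c : Carrier
      c = cCoeff K x y z x≉y x≉z

    powerSum : ℕ → Carrier
    powerSum n = x ^ n + y ^ n + z ^ n

    powerSum≈lucas : ∀ n → powerSum n ≈ lucas n
    powerSum≈lucas = tribonacci-unique
      (IsTribonacci-+ (IsTribonacci-+ (tribRoot-powers x-root) (tribRoot-powers y-root)) (tribRoot-powers z-root))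
      T-tribonacci
      (solve 0 (con (+ 1) :+ con (+ 1) :+ con (+ 1) := con (+ 3)) refl)
      (trans (solve 3 (λ x y z → x :* con (+ 1) :+ y :* con (+ 1) :+ z :* con (+ 1) := x :+ y :+ z) refl x y z)
             tribRoots-sum)
      (begin
        powerSum 2                                              ≈⟨ solve 3 (λ x y z →
          x :^ 2 :+ y :^ 2 :+ z :^ 2
          := (x :+ y :+ z) :* (x :+ y :+ z) :- con (+ 2) :* (x :* y :+ x :* z :+ y :* z)) refl x y z ⟩
        (x + y + z) * (x + y + z) - fromℕ 2 * (x * y + x * z + y * z)
          ≈⟨ +-cong (*-cong tribRoots-sum tribRoots-sum) (-‿cong (*-congˡ tribRoots-sumOfPairProducts)) ⟩
        1# * 1# - fromℕ 2 * - 1#                               ≈⟨ solve 0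
          (con (+ 1) :* con (+ 1) :- con (+ 2) :* :- con (+ 1) := con (+ 3)) refl ⟩
        fromℕ 3                                                 ∎)

  module DistinctRoots (char0 : CharZero K) {α β γ} (α-root : IsTribRoot K α) (β-root : IsTribRoot K β) (γ-root : IsTribRoot K γ)
                       (α≉β : ¬ (α ≈ β)) (α≉γ : ¬ (α ≈ γ)) (β≉γ : ¬ (β ≈ γ)) where

    private
      β≉α : ¬ (β ≈ α)
      β≉α e = α≉β (sym e)
      γ≉α : ¬ (γ ≈ α)
      γ≉α e = α≉γ (sym e)
      γ≉β : ¬ (γ ≈ β)
      γ≉β e = β≉γ (sym e)

    c₁ c₂ c₃ : Carrier
    c₁ = cCoeff K α β γ α≉β α≉γ
    c₂ = cCoeff K β α γ β≉α β≉γ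
    c₃ = cCoeff K γ α β γ≉α γ≉β

    private
      h : Carrier → Carrier
      h x = fromℕ 4 * x * x + x - fromℕ 3

    968*weightedPowerSum : ∀ n → fromℕ 968 * (c₁ ^ 4 * α ^ n + c₂ ^ 4 * β ^ n + c₃ ^ 4 * γ ^ n)
                                 ≈ fromℕ 2 * T K (fromℕ 2) (fromℕ 14) (fromℕ 21) n
    968*weightedPowerSum n = begin
      fromℕ 968 * (c₁ ^ 4 * α ^ n + c₂ ^ 4 * β ^ n + c₃ ^ 4 * γ ^ n)
        ≈⟨ solve 7 (λ c₁ c₂ c₃ a b g k →
             k :* (c₁ :* a :+ c₂ :* b :+ c₃ :* g) := k :* c₁ :* a :+ k :* c₂ :* b :+ k :* c₃ :* g)
             refl (c₁ ^ 4) (c₂ ^ 4) (c₃ ^ 4) (α ^ n) (β ^ n) (γ ^ n) (fromℕ 968) ⟩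
      fromℕ 968 * c₁ ^ 4 * α ^ n + fromℕ 968 * c₂ ^ 4 * β ^ n + fromℕ 968 * c₃ ^ 4 * γ ^ n
        ≈⟨ +-cong (+-cong (*-congʳ (968*cCoeff^4 α-root β-root γ-root α≉β α≉γ β≉γ char0))
                          (*-congʳ (968*cCoeff^4 β-root α-root γ-root β≉α β≉γ α≉γ char0)))
                  (*-congʳ (968*cCoeff^4 γ-root α-root β-root γ≉α γ≉β α≉β char0)) ⟩
      h α * α ^ n + h β * β ^ n + h γ * γ ^ n
        ≈⟨ solve 6 (λ a b g aⁿ bⁿ gⁿ →
             H a :* aⁿ :+ H b :* bⁿ :+ H g :* gⁿ
             := con (+ 4) :* (a :* (a :* aⁿ) :+ b :* (b :* bⁿ) :+ g :* (g :* gⁿ))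
                :+ (a :* aⁿ :+ b :* bⁿ :+ g :* gⁿ) :- con (+ 3) :* (aⁿ :+ bⁿ :+ gⁿ))
             refl α β γ (α ^ n) (β ^ n) (γ ^ n) ⟩
      fromℕ 4 * p (2 ℕ.+ n) + p (1 ℕ.+ n) - fromℕ 3 * p n
        ≈⟨ +-cong (+-cong (*-congˡ (p≈lucas (2 ℕ.+ n))) (p≈lucas (1 ℕ.+ n)))
                  (-‿cong (*-congˡ (p≈lucas n))) ⟩
      fromℕ 4 * lucas (2 ℕ.+ n) + lucas (1 ℕ.+ n) - fromℕ 3 * lucas n
        ≈⟨ lucas-combination n ⟩
      fromℕ 2 * T K (fromℕ 2) (fromℕ 14) (fromℕ 21) n ∎
      where
      p : ℕ → Carrier
      p = powerSum α-root β-root γ-root α≉β α≉γ β≉γ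
      p≈lucas : ∀ n → p n ≈ lucas n
      p≈lucas = powerSum≈lucas α-root β-root γ-root α≉β α≉γ β≉γ
      H : ∀ {m} → Polynomial m → Polynomial m
      H x = con (+ 4) :* x :* x :+ x :- con (+ 3)

    weightedPowerSum : ∀ n → c₁ ^ 4 * α ^ n + c₂ ^ 4 * β ^ n + c₃ ^ 4 * γ ^ n
                             ≈ (1# / fromℕ 484 ⟨ char0 483 ⟩) * T K (fromℕ 2) (fromℕ 14) (fromℕ 21) n
    weightedPowerSum n = *-cancelˡ (char0 967) (begin
      fromℕ 968 * (c₁ ^ 4 * α ^ n + c₂ ^ 4 * β ^ n + c₃ ^ 4 * γ ^ n) ≈⟨ 968*weightedPowerSum n ⟩
      fromℕ 2 * t                                                   ≈⟨ *-congˡ (*-identityˡ t) ⟨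
      fromℕ 2 * (1# * t)                                            ≈⟨ *-congˡ (*-congʳ (inverse (fromℕ 484) (char0 483))) ⟨
      fromℕ 2 * ((fromℕ 484 * v) * t)                               ≈⟨ solve 2 (λ v t →
        con (+ 2) :* ((con (+ 484) :* v) :* t) := con (+ 968) :* ((con (+ 1) :* v) :* t)) refl v t ⟩
      fromℕ 968 * ((1# * v) * t)                                    ∎)
      where
      t v : Carrier
      t = T K (fromℕ 2) (fromℕ 14) (fromℕ 21) n
      v = fromℕ 484 ⁻¹⟨ char0 483 ⟩

lemma8 : ∀ {c ℓ} (K : Field c ℓ) (char0 : CharZero K) →
    let open Field K
        open PowerSeries K char0
    in (α β γ : Carrier) →
       IsTribRoot K α → IsTribRoot K β → IsTribRoot K γ →
       (α≉β : ¬ (α ≈ β)) → (α≉γ : ¬ (α ≈ γ)) → (β≉γ : ¬ (β ≈ γ)) →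
       let c₁ = cCoeff K α β γ α≉β α≉γ
           c₂ = cCoeff K β α γ (λ e → α≉β (sym e)) β≉γ
           c₃ = cCoeff K γ α β (λ e → α≉γ (sym e)) (λ e → β≉γ (sym e))
       in ((c₁ ^ 4) ·ₛ exp α) +ₛ ((c₂ ^ 4) ·ₛ exp β) +ₛ ((c₃ ^ 4) ·ₛ exp γ)
          ≈ₛ ((1# / fromℕ 484 ⟨ char0 483 ⟩) ·ₛ egf (T K (fromℕ 2) (fromℕ 14) (fromℕ 21)))
lemma8 K char0 α β γ α-root β-root γ-root α≉β α≉γ β≉γ n = begin
  c₁ ^ 4 * (α ^ n * n!⁻¹) + c₂ ^ 4 * (β ^ n * n!⁻¹) + c₃ ^ 4 * (γ ^ n * n!⁻¹)
    ≈⟨ solve 7 (λ c₁ c₂ c₃ a b g i →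
         c₁ :* (a :* i) :+ c₂ :* (b :* i) :+ c₃ :* (g :* i) := (c₁ :* a :+ c₂ :* b :+ c₃ :* g) :* i)
         refl (c₁ ^ 4) (c₂ ^ 4) (c₃ ^ 4) (α ^ n) (β ^ n) (γ ^ n) n!⁻¹ ⟩
  (c₁ ^ 4 * α ^ n + c₂ ^ 4 * β ^ n + c₃ ^ 4 * γ ^ n) * n!⁻¹
    ≈⟨ *-congʳ (weightedPowerSum n) ⟩
  (1/484 * T K (fromℕ 2) (fromℕ 14) (fromℕ 21) n) * n!⁻¹
    ≈⟨ *-assoc _ _ _ ⟩
  1/484 * (T K (fromℕ 2) (fromℕ 14) (fromℕ 21) n * n!⁻¹) ∎
  where
  open Field K hiding (_×_)
  open PowerSeries K char0 using (fact≉0)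
  open IntegerCoefficientSolver commutativeRing
  open TribonacciRoots K
  open DistinctRoots char0 α-root β-root γ-root α≉β α≉γ β≉γ
  open SetoidReasoning setoid
  n!⁻¹ 1/484 : Carrier
  n!⁻¹ = fromℕ (n ℕ.!) ⁻¹⟨ fact≉0 n ⟩
  1/484 = 1# / fromℕ 484 ⟨ char0 483 ⟩
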